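{- Let $G$ be a directed cycle network with complexes $\mathbf{y}_1,\dots,\mathbf{y}_m$ and reactions $\mathbf{y}_i\to\mathbf{y}_{i+1}$ with positive rate constants $\kappa_i$ (indices modulo $m$), and let $d=\dim\ker\Sigma$. Then the chemical reaction system of $G$ satisfies the PDSC condition if and only if there exists a surjective coloring $\lambda:E(G)\to[d]$ of the edges of $G$ such that for all $\ell\in[d]$, \[\sum_{\mathbf{y}\in H(\ell)}\mathbf{y}=\sum_{\mathbf{y}\in T(\ell)}\mathbf{y}.\]
   Context: Complexes are vectors $\mathbf{y}_i\in\mathbb{Z}_{\ge0}^s$ indexed by $s$ species. $Y\in\mathbb{Z}^{m\times s}$ has rows $\mathbf{y}_i$; $A_{\boldsymbol\kappa}$ is the $m\times m$ matrix with $(i,i+1)$ entry $\kappa_i$ (indices mod $m$), diagonal $(i,i)$ entry $-\kappa_i$, and all other entries $0$; $\Sigma=Y^tA_{\boldsymbol\kappa}^t$. PDSC condition: with $d=\dim\ker\Sigma$ there exist a partition $I_1,\dots,I_d$ of $\{1,\dots,m\}$ and a basis $\mathbf{b}^1,\dots,\mathbf{b}^d$ of $\ker\Sigma$ with $\operatorname{supp}(\mathbf{b}^i)=I_i$ for each $i$. For an edge coloring $\lambda:E(G)\to C$ and a color $\ell$, $G[\ell]$ is the subgraph formed by the edges of color $\ell$; $H(\ell)$ is the set of source vertices of $G[\ell]$ (vertices with an outgoing but no incoming edge of color $\ell$) and $T(\ell)$ the set of sink vertices of $G[\ell]$ (vertices with an incoming but no outgoing edge of color $\ell$). In particular, if only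 one color is used then $H(\ell)=T(\ell)=\emptyset$. -}

module Defs where

open import Level using (Level; _⊔_) renaming (suc to lsuc; zero to lzero)
open import Algebra.Bundles using (CommutativeRing)
open import Relation.Binary.Structures using (IsStrictTotalOrder)
open import Data.Nat as ℕ using (ℕ; zero; suc)
open import Data.Fin as Fin using (Fin; toℕ; fromℕ<)
open import Data.Fin.Properties using (any?)
open import Data.Bool using (Bool; if_then_else_; _∧_; not)
open import Data.Product using (Σ; ∃; _×_; _,_)
open import Relation.Nullary using (¬_; Dec; yes; no)
open import Relation.Nullary.Decidable using (⌊_⌋; _×-dec_; ¬?)
open import Relation.Binary.PropositionalEquality using (_≡_; _≢_)
open import Function using (Surjective)

-- Ordered fields (the scalars; ℝ is the instance used in the paper)

record OrderedField c ℓ : Set (lsuc (c ⊔ ℓ)) where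
  field
    commutativeRing : CommutativeRing c ℓ
  open CommutativeRing commutativeRing public
  field
    _<_                 : Carrier → Carrier → Set ℓ
    <-isStrictTotalOrder : IsStrictTotalOrder _≈_ _<_
    0<1                 : 0# < 1#
    +-mono-<            : ∀ {x y} z → x < y → (x + z) < (y + z)
    *-pos               : ∀ {x y} → 0# < x → 0# < y → 0# < (x * y)
    *-inverse           : ∀ x → ¬ (x ≈ 0#) → ∃ λ y → (x * y) ≈ 1#

∑ℕ : ∀ {n} → (Fin n → ℕ) → ℕ
∑ℕ {zero}  f = 0
∑ℕ {suc n} f = f Fin.zero ℕ.+ ∑ℕ (λ i → f (Fin.suc i))

module _ {c ℓ} (F : OrderedField c ℓ) where
  open OrderedField F

  ∑ : ∀ {n} → (Fin n → Carrier) → Carrier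
  ∑ {zero}  f = 0#
  ∑ {suc n} f = f Fin.zero + ∑ (λ i → f (Fin.suc i))

  ι : ℕ → Carrier
  ι zero    = 0#
  ι (suc n) = 1# + ι n

csuc : ∀ {m} → Fin m → Fin m
csuc {suc n} j with suc (toℕ j) ℕ.<? suc n
... | yes p = fromℕ< p
... | no _  = Fin.zero

-- The cycle network y_1 → y_2 → … → y_m → y_1.
-- Complexes: Y : Fin m → Fin s → ℕ (row i is y_i).
-- Edges are indexed by Fin m: edge e goes from e to csuc e.

source : ∀ {m} → Fin m → Fin m
source e = e

target : ∀ {m} → Fin m → Fin m
target e = csuc e

module _ {c ℓ} (F : OrderedField c ℓ) where
  open OrderedField F

  -- A_κ : (i, i+1) entry κ_i, (i,i) entry -κ_i, others 0 (m ≥ 2 so i+1 ≠ i)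
  Aκ : ∀ {m} → (Fin m → Carrier) → Fin m → Fin m → Carrier
  Aκ κ i j =
    (if ⌊ j Fin.≟ csuc i ⌋ then κ i else 0#) +
    (if ⌊ j Fin.≟ i ⌋ then - (κ i) else 0#)

  -- Σ = Yᵗ Aκᵗ, an s × m matrix: Σ k j = ∑_i Y i k * Aκ j i
  Σmat : ∀ {m s} → (Fin m → Fin s → ℕ) → (Fin m → Carrier) →
         Fin s → Fin m → Carrier
  Σmat Y κ k j = ∑ F (λ i → ι F (Y i k) * Aκ κ j i)

  InKer : ∀ {m s} → (Fin s → Fin m → Carrier) → (Fin m → Carrier) → Set ℓ
  InKer M x = ∀ k → ∑ F (λ j → M k j * x j) ≈ 0#

  IsKerBasis : ∀ {m s d} → (Fin s → Fin m → Carrier) →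
               (Fin d → Fin m → Carrier) → Set (c ⊔ ℓ)
  IsKerBasis {m} {s} {d} M b =
    (∀ i → InKer M (b i)) ×
    (∀ (a : Fin d → Carrier) →
       (∀ j → ∑ F (λ i → a i * b i j) ≈ 0#) → ∀ i → a i ≈ 0#) ×
    (∀ x → InKer M x →
       ∃ λ (a : Fin d → Carrier) → ∀ j → x j ≈ ∑ F (λ i → a i * b i j))

  DimKer : ∀ {m s} → (Fin s → Fin m → Carrier) → ℕ → Set (c ⊔ ℓ)
  DimKer {m} M d = ∃ λ (b : Fin d → Fin m → Carrier) → IsKerBasis M b

  -- PDSC with d = dim ker Σ: a partition I_1,…,I_d of the complexes
  -- (given by the block-assignment p, every block nonempty) and a basis
  -- b^1,…,b^d of ker Σ with supp(b^i) = I_i.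
  PDSC : ∀ {m s} → (Fin m → Fin s → ℕ) → (Fin m → Carrier) → ℕ →
         Set (c ⊔ ℓ)
  PDSC {m} Y κ d =
    ∃ λ (p : Fin m → Fin d) → Surjective _≡_ _≡_ p ×
    ∃ λ (b : Fin d → Fin m → Carrier) → IsKerBasis (Σmat Y κ) b ×
      (∀ i j → (p j ≡ i → ¬ (b i j ≈ 0#)) × (¬ (b i j ≈ 0#) → p j ≡ i))

module _ {m d : ℕ} (col : Fin m → Fin d) (l : Fin d) where

  HasOut : Fin m → Set
  HasOut v = ∃ λ e → col e ≡ l × source e ≡ v

  HasIn : Fin m → Set
  HasIn v = ∃ λ e → col e ≡ l × target e ≡ v

  hasOut? : ∀ v → Dec (HasOut v)
  hasOut? v = any? (λ e → (col e Fin.≟ l) ×-dec (source e Fin.≟ v))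

  hasIn? : ∀ v → Dec (HasIn v)
  hasIn? v = any? (λ e → (col e Fin.≟ l) ×-dec (target e Fin.≟ v))

  inH : Fin m → Bool
  inH v = ⌊ hasOut? v ×-dec ¬? (hasIn? v) ⌋

  inT : Fin m → Bool
  inT v = ⌊ hasIn? v ×-dec ¬? (hasOut? v) ⌋

BalancedColour : ∀ {m s d} → (Fin m → Fin s → ℕ) → (Fin m → Fin d) →
                 Fin d → Set
BalancedColour Y col l =
  ∀ k → ∑ℕ (λ v → if inH col l v then Y v k else 0)
      ≡ ∑ℕ (λ v → if inT col l v then Y v k else 0)

GoodColoring : ∀ {m s} → (Fin m → Fin s → ℕ) → ℕ → Set
GoodColoring {m} Y d =
  ∃ λ (col : Fin m → Fin d) → Surjective _≡_ _≡_ col ×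
    (∀ l → BalancedColour Y col l)

module Submission where

-- Edge e of the cycle leaves complex e, so a partition of the complexes is the same thing as
-- an edge colouring. The kernel of Σ consists of the x with ∑ₑ κₑ xₑ (y_{e+1} − yₑ) = 0; it
-- contains κ⁻¹, whose sum telescopes around the cycle. For a colouring λ and a colour ℓ, the
-- restriction of κ⁻¹ to the edges of colour ℓ lies in ker Σ exactly when
-- ∑_{λ(e)=ℓ} (y_{e+1} − yₑ) = 0, and this sum is ∑_{T(ℓ)} y − ∑_{H(ℓ)} y because every vertex
-- of a cycle has one incoming and one outgoing edge. If a PDSC basis has supports λ⁻¹(ℓ),
-- expanding κ⁻¹ in it shows that each such restriction is a multiple of a basis vector, so λ
-- is balanced. Conversely, for a balanced surjective colouring the d restrictions of κ⁻¹ lie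
-- in ker Σ and have disjoint nonempty supports, hence are independent; since dim ker Σ = d
-- they form a basis, by the exchange lemma (proved by Gaussian elimination).

open import Defs
open import Data.Nat using (ℕ; _≤_)
open import Data.Fin using (Fin)
open import Function.Bundles using (_⇔_)
open import Relation.Binary.PropositionalEquality using (_≡_)

open import Level using (_⊔_)
open import Algebra.Bundles using (CommutativeMonoid)
import Algebra.Properties.CommutativeMonoid.Sum as CommutativeMonoidSum
import Algebra.Properties.Semiring.Sum as SemiringSum
import Algebra.Properties.CommutativeSemigroup as CommutativeSemigroupProperties
import Algebra.Properties.Group as GroupProperties
import Algebra.Properties.Ring as RingProperties
open import Data.Bool using (if_then_else_)
open import Data.Empty using (⊥-elim)
open import Data.Fin as Fin using (zero; suc; fromℕ; inject₁; punchIn; _≟_)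
open import Data.Fin.Properties
  using ( any?; suc-injective; 0≢1+n; punchInᵢ≢i
        ; toℕ-injective; toℕ-fromℕ<; toℕ-fromℕ; toℕ-inject₁; toℕ<n)
open import Data.Nat as ℕ using (_≤′_; ≤′-refl; ≤′-step; s≤s)
open import Data.Nat.Properties using (<-irrefl; <-cmp; ≤⇒≤′)
open import Data.Product as Product using (∃; ∃₂; _×_; _,_; proj₁; proj₂)
open import Data.Sum as Sum using (_⊎_; inj₁; inj₂)
open import Data.Vec.Functional using (insertAt; _∷_)
open import Data.Vec.Functional.Properties using (insertAt-lookup; insertAt-punchIn)
open import Function using (_∘_; id; Surjective)
open import Function.Bundles using (mk⇔; Equivalence)
open import Function.Construct.Composition using (_⇔-∘_)
open import Relation.Binary.Definitions using (tri<; tri≈; tri>)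
open import Relation.Binary.Structures using (IsStrictTotalOrder)
open import Relation.Binary.PropositionalEquality as ≡ using (_≢_; cong; subst)
import Relation.Binary.Reasoning.Setoid as SetoidReasoning
open import Relation.Nullary using (¬_; Dec; yes; no; contradiction)
open import Relation.Nullary.Decidable using (⌊_⌋; ¬?; _×-dec_; decidable-stable)

⌊⌋-⇔ : ∀ {a b} {A : Set a} {B : Set b} (a? : Dec A) (b? : Dec B) → A ⇔ B → ⌊ a? ⌋ ≡ ⌊ b? ⌋
⌊⌋-⇔ (yes _) (yes _) _   = ≡.refl
⌊⌋-⇔ (yes a) (no ¬b) A⇔B = contradiction (Equivalence.to A⇔B a) ¬b
⌊⌋-⇔ (no ¬a) (yes b) A⇔B = contradiction (Equivalence.from A⇔B b) ¬a
⌊⌋-⇔ (no _)  (no _)  _   = ≡.refl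

last-or-inject₁ : ∀ {n} (j : Fin (ℕ.suc n)) → j ≡ fromℕ n ⊎ ∃ λ i → j ≡ inject₁ i
last-or-inject₁ {ℕ.zero}  zero    = inj₁ ≡.refl
last-or-inject₁ {ℕ.suc n} zero    = inj₂ (zero , ≡.refl)
last-or-inject₁ {ℕ.suc n} (suc j) =
  Sum.map (cong suc) (Product.map suc (cong suc)) (last-or-inject₁ j)

csuc-inject₁ : ∀ {n} (i : Fin n) → csuc (inject₁ i) ≡ suc i
csuc-inject₁ {n} i with ℕ.suc (Fin.toℕ (inject₁ i)) ℕ.<? ℕ.suc n
... | yes i+1<n+1 = toℕ-injective (≡.trans (toℕ-fromℕ< i+1<n+1) (cong ℕ.suc (toℕ-inject₁ i)))
... | no  i+1≮n+1 = contradiction (s≤s (subst (ℕ._< n) (≡.sym (toℕ-inject₁ i)) (toℕ<n i))) i+1≮n+1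

csuc-fromℕ : ∀ n → csuc (fromℕ n) ≡ zero
csuc-fromℕ n with ℕ.suc (Fin.toℕ (fromℕ n)) ℕ.<? ℕ.suc n
... | yes n+1<n+1 = contradiction n+1<n+1 (<-irrefl (cong ℕ.suc (toℕ-fromℕ n)))
... | no  _       = ≡.refl

csuc-injective : ∀ {m} {i j : Fin m} → csuc i ≡ csuc j → i ≡ j
csuc-injective {ℕ.suc n} {i} {j} eq with last-or-inject₁ i | last-or-inject₁ j
... | inj₁ ≡.refl        | inj₁ ≡.refl        = ≡.refl
... | inj₁ ≡.refl        | inj₂ (j′ , ≡.refl) =
  ⊥-elim (0≢1+n (≡.trans (≡.sym (csuc-fromℕ n)) (≡.trans eq (csuc-inject₁ j′))))
... | inj₂ (i′ , ≡.refl) | inj₁ ≡.refl        =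
  ⊥-elim (0≢1+n (≡.trans (≡.sym (csuc-fromℕ n)) (≡.trans (≡.sym eq) (csuc-inject₁ i′))))
... | inj₂ (i′ , ≡.refl) | inj₂ (j′ , ≡.refl) =
  cong inject₁ (suc-injective (≡.trans (≡.sym (csuc-inject₁ i′)) (≡.trans eq (csuc-inject₁ j′))))

module _ {a ℓ} (M : CommutativeMonoid a ℓ) where
  open CommutativeMonoid M
  open CommutativeMonoidSum M using (sum; sum-init-last; sum-cong-≗)
  open SetoidReasoning setoid

  sum-rotate : ∀ {m} (f : Fin m → Carrier) → sum (f ∘ csuc) ≈ sum f
  sum-rotate {ℕ.zero}  f = refl
  sum-rotate {ℕ.suc n} f = begin
    sum (f ∘ csuc)                                 ≈⟨ sum-init-last (f ∘ csuc) ⟩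
    sum (f ∘ csuc ∘ inject₁) ∙ f (csuc (fromℕ n))
      ≡⟨ ≡.cong₂ _∙_ (sum-cong-≗ (cong f ∘ csuc-inject₁)) (cong f (csuc-fromℕ n)) ⟩
    sum (f ∘ suc) ∙ f zero                         ≈⟨ comm _ _ ⟩
    sum f                                          ∎

module FieldProperties {c ℓ} (F : OrderedField c ℓ) where
  open OrderedField F hiding (zero)
  open IsStrictTotalOrder <-isStrictTotalOrder public using () renaming (_≟_ to _≈?_)
  open IsStrictTotalOrder <-isStrictTotalOrder using (irrefl; <-respˡ-≈) renaming (trans to <-trans)
  open GroupProperties +-group using (x∙y⁻¹≈ε⇒x≈y; x≈y⇒x∙y⁻¹≈ε; ∙-cancelˡ; ∙-cancelʳ)
  open RingProperties ring using (-1*x≈-x)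
  module Sums = SemiringSum semiring
  open SetoidReasoning setoid

  ≈-stable : ∀ {x y} → ¬ ¬ x ≈ y → x ≈ y
  ≈-stable = decidable-stable (_ ≈? _)

  >0⇒≉0 : ∀ {x} → 0# < x → x ≉ 0#
  >0⇒≉0 0<x x≈0 = irrefl (sym x≈0) 0<x

  1≉0 : 1# ≉ 0#
  1≉0 = >0⇒≉0 0<1

  x*y≈0⇒x≈0 : ∀ {x y} → y ≉ 0# → x * y ≈ 0# → x ≈ 0#
  x*y≈0⇒x≈0 {x} {y} y≉0 xy≈0 with *-inverse y y≉0
  ... | y⁻¹ , yy⁻¹≈1 = begin
    x              ≈⟨ *-identityʳ x ⟨
    x * 1#         ≈⟨ *-congˡ yy⁻¹≈1 ⟨
    x * (y * y⁻¹)  ≈⟨ *-assoc x y y⁻¹ ⟨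
    (x * y) * y⁻¹  ≈⟨ *-congʳ xy≈0 ⟩
    0# * y⁻¹       ≈⟨ zeroˡ y⁻¹ ⟩
    0#             ∎

  x*y≈1⇒y≉0 : ∀ {x y} → x * y ≈ 1# → y ≉ 0#
  x*y≈1⇒y≉0 {x} {y} xy≈1 y≈0 = 1≉0 (begin
    1#      ≈⟨ xy≈1 ⟨
    x * y   ≈⟨ *-congˡ y≈0 ⟩
    x * 0#  ≈⟨ zeroʳ x ⟩
    0#      ∎)

  x-y≈0⇔x≈y : ∀ {x y} → (x - y ≈ 0#) ⇔ (x ≈ y)
  x-y≈0⇔x≈y = mk⇔ (x∙y⁻¹≈ε⇒x≈y _ _) x≈y⇒x∙y⁻¹≈ε

  +-exchange : ∀ {x y u v} → x + u ≈ y + v → (x ≈ y) ⇔ (u ≈ v)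
  +-exchange {x} {y} {u} {v} x+u≈y+v = mk⇔
    (λ x≈y → ∙-cancelˡ y u v (trans (+-congʳ (sym x≈y)) x+u≈y+v))
    (λ u≈v → ∙-cancelʳ u x y (trans x+u≈y+v (+-congˡ (sym u≈v))))

  ∑≈sum : ∀ {n} (f : Fin n → Carrier) → ∑ F f ≈ Sums.sum f
  ∑≈sum {ℕ.zero}  f = refl
  ∑≈sum {ℕ.suc n} f = +-congˡ (∑≈sum (f ∘ suc))

  ∑-cong : ∀ {n} {f g : Fin n → Carrier} → (∀ i → f i ≈ g i) → ∑ F f ≈ ∑ F g
  ∑-cong {f = f} {g} f≈g = trans (∑≈sum f) (trans (Sums.sum-cong-≋ f≈g) (sym (∑≈sum g)))

  ∑-zero : ∀ {n} {f : Fin n → Carrier} → (∀ i → f i ≈ 0#) → ∑ F f ≈ 0#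
  ∑-zero {n} f≈0 = trans (∑-cong f≈0) (trans (∑≈sum {n} (λ _ → 0#)) (Sums.sum-replicate-zero n))

  ∑-distrib-+ : ∀ {n} (f g : Fin n → Carrier) → ∑ F (λ i → f i + g i) ≈ ∑ F f + ∑ F g
  ∑-distrib-+ f g =
    trans (∑≈sum (λ i → f i + g i)) (trans (Sums.∑-distrib-+ f g) (sym (+-cong (∑≈sum f) (∑≈sum g))))

  *-distribˡ-∑ : ∀ {n} x (f : Fin n → Carrier) → x * ∑ F f ≈ ∑ F (λ i → x * f i)
  *-distribˡ-∑ x f =
    trans (*-congˡ (∑≈sum f)) (trans (Sums.*-distribˡ-sum x f) (sym (∑≈sum (λ i → x * f i))))

  *-distribʳ-∑ : ∀ {n} x (f : Fin n → Carrier) → ∑ F f * x ≈ ∑ F (λ i → f i * x)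
  *-distribʳ-∑ x f =
    trans (*-congʳ (∑≈sum f)) (trans (Sums.*-distribʳ-sum x f) (sym (∑≈sum (λ i → f i * x))))

  ∑-distrib-- : ∀ {n} (f g : Fin n → Carrier) → ∑ F (λ i → f i - g i) ≈ ∑ F f - ∑ F g
  ∑-distrib-- f g = trans (∑-distrib-+ f (λ i → - g i)) (+-congˡ ∑-neg)
    where
    ∑-neg : ∑ F (λ i → - g i) ≈ - ∑ F g
    ∑-neg = begin
      ∑ F (λ i → - g i)       ≈⟨ ∑-cong (λ i → -1*x≈-x (g i)) ⟨
      ∑ F (λ i → - 1# * g i)  ≈⟨ *-distribˡ-∑ (- 1#) g ⟨
      - 1# * ∑ F g            ≈⟨ -1*x≈-x (∑ F g) ⟩
      - ∑ F g                 ∎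

  ∑-comm : ∀ {m n} (f : Fin m → Fin n → Carrier) →
           ∑ F (λ i → ∑ F (f i)) ≈ ∑ F (λ j → ∑ F (λ i → f i j))
  ∑-comm f = begin
    ∑ F (λ i → ∑ F (f i))                     ≈⟨ ∑-cong (λ i → ∑≈sum (f i)) ⟩
    ∑ F (λ i → Sums.sum (f i))                ≈⟨ ∑≈sum (λ i → Sums.sum (f i)) ⟩
    Sums.sum (λ i → Sums.sum (f i))           ≈⟨ Sums.∑-comm f ⟩
    Sums.sum (λ j → Sums.sum (λ i → f i j))   ≈⟨ ∑≈sum (λ j → Sums.sum (λ i → f i j)) ⟨
    ∑ F (λ j → Sums.sum (λ i → f i j))        ≈⟨ ∑-cong (λ j → ∑≈sum (λ i → f i j)) ⟨
    ∑ F (λ j → ∑ F (λ i → f i j))             ∎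

  ∑-removeAt : ∀ {n} (r : Fin (ℕ.suc n)) (f : Fin (ℕ.suc n) → Carrier) →
               ∑ F f ≈ f r + ∑ F (f ∘ punchIn r)
  ∑-removeAt r f =
    trans (∑≈sum f) (trans (Sums.sum-remove {i = r} f) (+-congˡ (sym (∑≈sum (f ∘ punchIn r)))))

  ∑-select : ∀ {n} (r : Fin n) {f : Fin n → Carrier} → (∀ i → i ≢ r → f i ≈ 0#) → ∑ F f ≈ f r
  ∑-select {ℕ.suc n} r {f} f≈0 = begin
    ∑ F f                      ≈⟨ ∑-removeAt r f ⟩
    f r + ∑ F (f ∘ punchIn r)  ≈⟨ +-congˡ (∑-zero (λ i → f≈0 _ (punchInᵢ≢i r i))) ⟩
    f r + 0#                   ≈⟨ +-identityʳ (f r) ⟩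
    f r                        ∎

  ∑-rotate : ∀ {m} (f : Fin m → Carrier) → ∑ F (f ∘ csuc) ≈ ∑ F f
  ∑-rotate f = trans (∑≈sum (f ∘ csuc)) (trans (sum-rotate +-commutativeMonoid f) (sym (∑≈sum f)))

  ι-∑ : ∀ {n} (f : Fin n → ℕ) → ι F (∑ℕ f) ≈ ∑ F (ι F ∘ f)
  ι-∑ {ℕ.zero}  f = refl
  ι-∑ {ℕ.suc n} f = trans (ι-+ (f zero) _) (+-congˡ (ι-∑ (f ∘ suc)))
    where
    ι-+ : ∀ a b → ι F (a ℕ.+ b) ≈ ι F a + ι F b
    ι-+ ℕ.zero    b = sym (+-identityˡ (ι F b))
    ι-+ (ℕ.suc a) b = trans (+-congˡ (ι-+ a b)) (sym (+-assoc 1# _ _))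

  ι-<-suc : ∀ n → ι F n < ι F (ℕ.suc n)
  ι-<-suc n = <-respˡ-≈ (+-identityˡ (ι F n)) (+-mono-< (ι F n) 0<1)

  ι-strictMono : ∀ {a b} → ℕ.suc a ≤′ b → ι F a < ι F b
  ι-strictMono {a} ≤′-refl                  = ι-<-suc a
  ι-strictMono {b = ℕ.suc b} (≤′-step a<b) = <-trans (ι-strictMono a<b) (ι-<-suc b)

  ι-injective : ∀ {a b} → ι F a ≈ ι F b → a ≡ b
  ι-injective {a} {b} ιa≈ιb with <-cmp a b
  ... | tri< a<b _ _ = contradiction (ι-strictMono (≤⇒≤′ a<b)) (irrefl ιa≈ιb)
  ... | tri≈ _ a≡b _ = a≡b
  ... | tri> _ _ b<a = contradiction (ι-strictMono (≤⇒≤′ b<a)) (irrefl (sym ιa≈ιb))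

module LinearAlgebra {c ℓ} (F : OrderedField c ℓ) where
  open OrderedField F hiding (zero)
  open FieldProperties F
  open RingProperties ring using (-‿distribˡ-*; -‿distribʳ-*; x[y-z]≈xy-xz)
  open GroupProperties +-group using (inverseˡ-unique)
  open CommutativeSemigroupProperties *-commutativeSemigroup using (x∙yz≈y∙xz)
  open SetoidReasoning setoid

  private variable
    m n s d : ℕ

  lincomb : (Fin n → Carrier) → (Fin n → Fin m → Carrier) → Fin m → Carrier
  lincomb a v j = ∑ F (λ i → a i * v i j)

  Nontrivial : (Fin n → Carrier) → Set ℓ
  Nontrivial a = ∃ λ i → a i ≉ 0#

  Dependent : (Fin n → Fin m → Carrier) → Set (c ⊔ ℓ)
  Dependent v = ∃ λ a → Nontrivial a × (∀ j → lincomb a v j ≈ 0#)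

  Independent : (Fin n → Fin m → Carrier) → Set (c ⊔ ℓ)
  Independent v = ∀ a → (∀ j → lincomb a v j ≈ 0#) → ∀ i → a i ≈ 0#

  InSpan : (Fin n → Fin m → Carrier) → (Fin m → Carrier) → Set (c ⊔ ℓ)
  InSpan v x = ∃ λ a → ∀ j → x j ≈ lincomb a v j

  SpansKer : (Fin s → Fin m → Carrier) → (Fin n → Fin m → Carrier) → Set (c ⊔ ℓ)
  SpansKer M v = ∀ x → InKer F M x → InSpan v x

  InKer-cong : ∀ {M : Fin s → Fin m → Carrier} {x y} →
               (∀ j → x j ≈ y j) → InKer F M x → InKer F M y
  InKer-cong x≈y Mx≈0 k = trans (∑-cong (λ j → *-congˡ (sym (x≈y j)))) (Mx≈0 k)

  InKer-scale : ∀ {M : Fin s → Fin m → Carrier} {x} a →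
                InKer F M x → InKer F M (λ j → a * x j)
  InKer-scale {M = M} {x} a Mx≈0 k = begin
    ∑ F (λ j → M k j * (a * x j))  ≈⟨ ∑-cong (λ j → x∙yz≈y∙xz (M k j) a (x j)) ⟩
    ∑ F (λ j → a * (M k j * x j))  ≈⟨ *-distribˡ-∑ a (λ j → M k j * x j) ⟨
    a * ∑ F (λ j → M k j * x j)    ≈⟨ *-congˡ (Mx≈0 k) ⟩
    a * 0#                         ≈⟨ zeroʳ a ⟩
    0#                             ∎

  pivot : (w : Fin (ℕ.suc n) → Carrier) →
          ∃₂ λ r (q : Fin n → Carrier) → ∀ i → w (punchIn r i) ≈ q i * w r
  pivot w with any? (λ r → ¬? (w r ≈? 0#))
  ... | no all≈0 = zero , (λ _ → 0#) , λ i →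
    trans (≈-stable (λ wᵢ≉0 → all≈0 (suc i , wᵢ≉0))) (sym (zeroˡ (w zero)))
  ... | yes (r , wᵣ≉0) with *-inverse (w r) wᵣ≉0
  ...   | t , wᵣt≈1 = r , (λ i → w (punchIn r i) * t) , λ i → begin
    w (punchIn r i)                ≈⟨ *-identityʳ _ ⟨
    w (punchIn r i) * 1#           ≈⟨ *-congˡ (trans (*-comm t (w r)) wᵣt≈1) ⟨
    w (punchIn r i) * (t * w r)    ≈⟨ *-assoc _ _ _ ⟨
    (w (punchIn r i) * t) * w r    ∎

  -- Gaussian elimination on the first coordinate: after subtracting q i times the pivot
  -- vector r from the others, a dependency a among them lifts to the dependency lift r q a.

  lift : Fin (ℕ.suc n) → (Fin n → Carrier) → (Fin n → Carrier) → Fin (ℕ.suc n) → Carrier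
  lift r q a = insertAt a r (- ∑ F (λ i → a i * q i))

  ∑-lift : ∀ r (q a : Fin n → Carrier) (v : Fin (ℕ.suc n) → Carrier) →
           ∑ F (λ i → lift r q a i * v i) ≈ ∑ F (λ i → a i * (v (punchIn r i) - q i * v r))
  ∑-lift r q a v = begin
    ∑ F (λ i → lift r q a i * v i)
      ≈⟨ ∑-removeAt r (λ i → lift r q a i * v i) ⟩
    lift r q a r * v r + ∑ F (λ i → lift r q a (punchIn r i) * v (punchIn r i))
      ≈⟨ +-cong (*-congʳ (reflexive (insertAt-lookup a r _)))
                (∑-cong (λ i → *-congʳ (reflexive (insertAt-punchIn a r _ i)))) ⟩
    - S * v r + ∑ F (λ i → a i * v (punchIn r i))
      ≈⟨ +-comm _ _ ⟩
    ∑ F (λ i → a i * v (punchIn r i)) + - S * v r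
      ≈⟨ +-congˡ (-‿distribˡ-* S (v r)) ⟨
    ∑ F (λ i → a i * v (punchIn r i)) - S * v r
      ≈⟨ +-congˡ (-‿cong (*-distribʳ-∑ (v r) (λ i → a i * q i))) ⟩
    ∑ F (λ i → a i * v (punchIn r i)) - ∑ F (λ i → (a i * q i) * v r)
      ≈⟨ ∑-distrib-- (λ i → a i * v (punchIn r i)) (λ i → (a i * q i) * v r) ⟨
    ∑ F (λ i → a i * v (punchIn r i) - (a i * q i) * v r)
      ≈⟨ ∑-cong (λ i → trans (+-congˡ (-‿cong (*-assoc _ _ _)))
                             (sym (x[y-z]≈xy-xz (a i) _ _))) ⟩
    ∑ F (λ i → a i * (v (punchIn r i) - q i * v r)) ∎
    where
    S : Carrier
    S = ∑ F (λ i → a i * q i)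

  more-vectors-than-coordinates⇒dependent : (v : Fin (ℕ.suc n) → Fin n → Carrier) → Dependent v
  more-vectors-than-coordinates⇒dependent {ℕ.zero} v = (λ _ → 1#) , (zero , 1≉0) , λ ()
  more-vectors-than-coordinates⇒dependent {ℕ.suc n} v with pivot (λ i → v i zero)
  ... | r , q , v-pivot
    with more-vectors-than-coordinates⇒dependent (λ i k → v (punchIn r i) (suc k) - q i * v r (suc k))
  ... | a , (i₀ , aᵢ₀≉0) , a-solves = lift r q a , (punchIn r i₀ , liftᵢ₀≉0) , lift-solves
    where
    liftᵢ₀≉0 : lift r q a (punchIn r i₀) ≉ 0#
    liftᵢ₀≉0 = aᵢ₀≉0 ∘ trans (reflexive (≡.sym (insertAt-punchIn a r _ i₀)))

    lift-solves : ∀ k → lincomb (lift r q a) v k ≈ 0#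
    lift-solves zero    = trans (∑-lift r q a (λ i → v i zero))
      (∑-zero (λ i → trans (*-congˡ (Equivalence.from x-y≈0⇔x≈y (v-pivot i))) (zeroʳ (a i))))
    lift-solves (suc k) = trans (∑-lift r q a (λ i → v i (suc k))) (a-solves k)

  spanned-by-fewer⇒dependent : (w : Fin n → Fin m → Carrier) (u : Fin (ℕ.suc n) → Fin m → Carrier) →
                               (∀ i → InSpan w (u i)) → Dependent u
  spanned-by-fewer⇒dependent {n} w u u∈span
    with more-vectors-than-coordinates⇒dependent (λ i → proj₁ (u∈span i))
  ... | a , a-nontrivial , a-solves = a , a-nontrivial , λ j → begin
    lincomb a u j
      ≈⟨ ∑-cong (λ i → *-congˡ {a i} (proj₂ (u∈span i) j)) ⟩
    ∑ F (λ i → a i * ∑ F (λ k → C i k * w k j))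
      ≈⟨ ∑-cong (λ i → *-distribˡ-∑ (a i) (λ k → C i k * w k j)) ⟩
    ∑ F (λ i → ∑ F (λ k → a i * (C i k * w k j)))
      ≈⟨ ∑-comm (λ i k → a i * (C i k * w k j)) ⟩
    ∑ F (λ k → ∑ F (λ i → a i * (C i k * w k j)))
      ≈⟨ ∑-cong (λ k → trans (∑-cong (λ i → sym (*-assoc (a i) (C i k) (w k j))))
                                 (sym (*-distribʳ-∑ (w k j) (λ i → a i * C i k)))) ⟩
    ∑ F (λ k → lincomb a C k * w k j)
      ≈⟨ ∑-zero (λ k → trans (*-congʳ (a-solves k)) (zeroˡ (w k j))) ⟩
    0# ∎
    where
    C : Fin (ℕ.suc n) → Fin n → Carrier
    C i = proj₁ (u∈span i)

  independent⇒spansKer : ∀ {M : Fin s → Fin m → Carrier} {b v : Fin d → Fin m → Carrier} →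
                         SpansKer M b → (∀ l → InKer F M (v l)) → Independent v → SpansKer M v
  independent⇒spansKer {b = b} {v} b-spans v∈ker v-independent x x∈ker
    with spanned-by-fewer⇒dependent b (x ∷ v)
           (λ { zero → b-spans x x∈ker ; (suc l) → b-spans (v l) (v∈ker l) })
  ... | a , (i₀ , aᵢ₀≉0) , a-solves with a zero ≈? 0#
  ...   | yes a₀≈0 = ⊥-elim (aᵢ₀≉0 (all≈0 i₀))
    where
    all≈0 : ∀ i → a i ≈ 0#
    all≈0 zero    = a₀≈0
    all≈0 (suc l) = v-independent (a ∘ suc) (λ j → begin
      lincomb (a ∘ suc) v j              ≈⟨ +-identityˡ _ ⟨
      0# + lincomb (a ∘ suc) v j         ≈⟨ +-congʳ (trans (*-congʳ a₀≈0) (zeroˡ (x j))) ⟨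
      a zero * x j + lincomb (a ∘ suc) v j ≈⟨ a-solves j ⟩
      0#                                 ∎) l
  ...   | no a₀≉0 with *-inverse (a zero) a₀≉0
  ...     | t , a₀t≈1 = (λ l → - t * a (suc l)) , λ j → begin
    x j                                   ≈⟨ *-identityˡ (x j) ⟨
    1# * x j                              ≈⟨ *-congʳ (trans (*-comm t (a zero)) a₀t≈1) ⟨
    (t * a zero) * x j                    ≈⟨ *-assoc t _ _ ⟩
    t * (a zero * x j)                    ≈⟨ *-congˡ (inverseˡ-unique _ _ (a-solves j)) ⟩
    t * - lincomb (a ∘ suc) v j           ≈⟨ -‿distribʳ-* t _ ⟨
    - (t * lincomb (a ∘ suc) v j)         ≈⟨ -‿distribˡ-* t _ ⟩
    - t * lincomb (a ∘ suc) v j           ≈⟨ *-distribˡ-∑ (- t) (λ l → a (suc l) * v l j) ⟩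
    ∑ F (λ l → - t * (a (suc l) * v l j)) ≈⟨ ∑-cong (λ l → *-assoc (- t) (a (suc l)) (v l j)) ⟨
    lincomb (λ l → - t * a (suc l)) v j   ∎

  BlockSupported : (Fin m → Fin d) → (Fin d → Fin m → Carrier) → Set ℓ
  BlockSupported p b = ∀ i j → (p j ≡ i → b i j ≉ 0#) × (b i j ≉ 0# → p j ≡ i)

  restrict : (Fin m → Fin d) → Fin d → (Fin m → Carrier) → Fin m → Carrier
  restrict p l x j = if ⌊ p j ≟ l ⌋ then x j else 0#

  restrict-≡ : ∀ (p : Fin m → Fin d) x j {l} → p j ≡ l → restrict p l x j ≡ x j
  restrict-≡ p x j {l} pj≡l with p j ≟ l
  ... | yes _    = ≡.refl
  ... | no pj≢l = contradiction pj≡l pj≢l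

  restrict-≢ : ∀ (p : Fin m → Fin d) x j {l} → p j ≢ l → restrict p l x j ≡ 0#
  restrict-≢ p x j {l} pj≢l with p j ≟ l
  ... | yes pj≡l = contradiction pj≡l pj≢l
  ... | no _     = ≡.refl

  ∑-*-indicator : ∀ (f : Fin m → Carrier) l v → ∑ F (λ i → f i * restrict id l (λ _ → v) i) ≈ f l * v
  ∑-*-indicator f l v =
    trans (∑-select l (λ i i≢l →
             trans (*-congˡ (reflexive (restrict-≢ id (λ _ → v) i i≢l))) (zeroʳ (f i))))
          (*-congˡ (reflexive (restrict-≡ id (λ _ → v) l ≡.refl)))

  off-block≈0 : ∀ {p : Fin m → Fin d} {b} → BlockSupported p b → ∀ {i j} → p j ≢ i → b i j ≈ 0#
  off-block≈0 b-supp pj≢i = ≈-stable (pj≢i ∘ proj₂ (b-supp _ _))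

  lincomb-blockSupported : ∀ {p : Fin m → Fin d} {b} → BlockSupported p b →
                           ∀ a j → lincomb a b j ≈ a (p j) * b (p j) j
  lincomb-blockSupported b-supp a j =
    ∑-select _ (λ i i≢pj → trans (*-congˡ (off-block≈0 b-supp (i≢pj ∘ ≡.sym))) (zeroʳ (a i)))

  blockSupported⇒independent : ∀ {p : Fin m → Fin d} {b} →
                               Surjective _≡_ _≡_ p → BlockSupported p b → Independent b
  blockSupported⇒independent {p = p} {b} p-surj b-supp a ab≈0 l with p-surj l
  ... | j , pj≡l = subst (λ i → a i ≈ 0#) (pj≡l ≡.refl)
    (x*y≈0⇒x≈0 (proj₁ (b-supp _ j) ≡.refl) (trans (sym (lincomb-blockSupported b-supp a j)) (ab≈0 j)))

  restrict-blockSupported : ∀ {p : Fin m → Fin d} {x} →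
                            (∀ j → x j ≉ 0#) → BlockSupported p (λ l → restrict p l x)
  restrict-blockSupported {p = p} {x} x≉0 i j =
    (λ pj≡i → x≉0 j ∘ trans (reflexive (≡.sym (restrict-≡ p x j pj≡i)))) ,
    λ restrict≉0 → decidable-stable (p j ≟ i) (λ pj≢i → restrict≉0 (reflexive (restrict-≢ p x j pj≢i)))

  -- Restricting a kernel vector to a block of a block-supported basis
  -- isolates one term of its expansion.
  restrict-inKer : ∀ {M : Fin s → Fin m → Carrier} {p : Fin m → Fin d} {b x} →
                   IsKerBasis F M b → BlockSupported p b →
                   InKer F M x → ∀ l → InKer F M (restrict p l x)
  restrict-inKer {M = M} {p} {b} {x} (b∈ker , _ , b-spans) b-supp x∈ker l with b-spans x x∈ker
  ... | a , x≈ab = InKer-cong {M = M} restrict≈ab (InKer-scale {M = M} (a l) (b∈ker l))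
    where
    restrict≈ab : ∀ j → a l * b l j ≈ restrict p l x j
    restrict≈ab j with p j ≟ l
    ... | yes ≡.refl = sym (trans (x≈ab j) (lincomb-blockSupported b-supp a j))
    ... | no pj≢l = trans (*-congˡ (off-block≈0 b-supp pj≢l)) (zeroʳ (a l))

module CycleNetwork {c ℓ} (F : OrderedField c ℓ) {m s : ℕ} (Y : Fin m → Fin s → ℕ)
                    (κ : Fin m → OrderedField.Carrier F)
                    (κ>0 : ∀ e → OrderedField._<_ F (OrderedField.0# F) (κ e)) where
  open OrderedField F hiding (zero)
  open FieldProperties F
  open LinearAlgebra F
  open RingProperties ring using (-‿distribʳ-*)
  open SetoidReasoning setoid

  y : Fin m → Fin s → Carrier
  y v k = ι F (Y v k)

  Δ : Fin m → Fin s → Carrier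
  Δ e k = y (target e) k - y (source e) k

  Σmat-entry : ∀ k e → Σmat F Y κ k e ≈ κ e * Δ e k
  Σmat-entry k e = begin
    Σmat F Y κ k e
      ≈⟨ ∑-cong (λ i → distribˡ (y i k) _ _) ⟩
    ∑ F (λ i → entering i + leaving i)
      ≈⟨ ∑-distrib-+ entering leaving ⟩
    ∑ F entering + ∑ F leaving
      ≈⟨ +-cong (∑-*-indicator (λ i → y i k) (csuc e) (κ e)) (∑-*-indicator (λ i → y i k) e (- κ e)) ⟩
    y (csuc e) k * κ e + y e k * - κ e
      ≈⟨ +-cong (*-comm _ _)
                (trans (sym (-‿distribʳ-* _ _)) (trans (-‿cong (*-comm _ _)) (-‿distribʳ-* _ _))) ⟩
    κ e * y (csuc e) k + κ e * - y e k
      ≈⟨ distribˡ (κ e) _ _ ⟨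
    κ e * Δ e k ∎
    where
    entering leaving : Fin m → Carrier
    entering i = y i k * restrict id (csuc e) (λ _ → κ e) i
    leaving  i = y i k * restrict id e (λ _ → - κ e) i

  Σmat-action : ∀ (x : Fin m → Carrier) k →
                ∑ F (λ e → Σmat F Y κ k e * x e) ≈ ∑ F (λ e → (κ e * x e) * Δ e k)
  Σmat-action x k = ∑-cong λ e → begin
    Σmat F Y κ k e * x e  ≈⟨ *-congʳ (Σmat-entry k e) ⟩
    (κ e * Δ e k) * x e   ≈⟨ *-assoc _ _ _ ⟩
    κ e * (Δ e k * x e)   ≈⟨ *-congˡ (*-comm _ _) ⟩
    κ e * (x e * Δ e k)   ≈⟨ *-assoc _ _ _ ⟨
    (κ e * x e) * Δ e k   ∎

  κ⁻¹ : Fin m → Carrier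
  κ⁻¹ e = proj₁ (*-inverse (κ e) (>0⇒≉0 (κ>0 e)))

  κκ⁻¹≈1 : ∀ e → κ e * κ⁻¹ e ≈ 1#
  κκ⁻¹≈1 e = proj₂ (*-inverse (κ e) (>0⇒≉0 (κ>0 e)))

  κ⁻¹≉0 : ∀ e → κ⁻¹ e ≉ 0#
  κ⁻¹≉0 e = x*y≈1⇒y≉0 (κκ⁻¹≈1 e)

  κ⁻¹-inKer : InKer F (Σmat F Y κ) κ⁻¹
  κ⁻¹-inKer k = begin
    ∑ F (λ e → Σmat F Y κ k e * κ⁻¹ e)      ≈⟨ Σmat-action κ⁻¹ k ⟩
    ∑ F (λ e → (κ e * κ⁻¹ e) * Δ e k)
      ≈⟨ ∑-cong (λ e → trans (*-congʳ (κκ⁻¹≈1 e)) (*-identityˡ _)) ⟩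
    ∑ F (λ e → Δ e k)                       ≈⟨ ∑-distrib-- (λ e → y (csuc e) k) (λ e → y e k) ⟩
    ∑ F (λ e → y (csuc e) k) - ∑ F (λ e → y e k)
      ≈⟨ Equivalence.from x-y≈0⇔x≈y (∑-rotate (λ v → y v k)) ⟩
    0# ∎

  module _ {d} (col : Fin m → Fin d) (l : Fin d) where

    inflow outflow : Fin s → Carrier
    inflow  k = ∑ F (restrict col l (λ e → y (target e) k))
    outflow k = ∑ F (restrict col l (λ e → y (source e) k))

    sources sinks : Fin s → Fin m → ℕ
    sources k v = if inH col l v then Y v k else 0
    sinks   k v = if inT col l v then Y v k else 0

    restricted-κ⁻¹-action : ∀ k →
      ∑ F (λ e → Σmat F Y κ k e * restrict col l κ⁻¹ e) ≈ inflow k - outflow k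
    restricted-κ⁻¹-action k = trans (Σmat-action (restrict col l κ⁻¹) k)
      (trans (∑-cong flow) (∑-distrib-- (restrict col l (λ e → y (target e) k))
                                         (restrict col l (λ e → y (source e) k))))
      where
      flow : ∀ e → (κ e * restrict col l κ⁻¹ e) * Δ e k ≈
                   restrict col l (λ e → y (target e) k) e - restrict col l (λ e → y (source e) k) e
      flow e with col e ≟ l
      ... | yes _ = trans (*-congʳ (κκ⁻¹≈1 e)) (*-identityˡ _)
      ... | no  _ = trans (*-congʳ (zeroʳ (κ e))) (trans (zeroˡ _) (sym (-‿inverseʳ 0#)))

    hasIn⇔ : ∀ e → (col e ≡ l) ⇔ HasIn col l (csuc e)
    hasIn⇔ e = mk⇔ (λ col-e → e , col-e , ≡.refl)
                   (λ (e′ , col-e′ , e′↦e) → subst (λ i → col i ≡ l) (csuc-injective e′↦e) col-e′)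

    hasOut⇔ : ∀ e → (col e ≡ l) ⇔ HasOut col l e
    hasOut⇔ e = mk⇔ (λ col-e → e , col-e , ≡.refl)
                    (λ (e′ , col-e′ , e′≡e) → subst (λ i → col i ≡ l) e′≡e col-e′)

    -- Each vertex is the target of exactly one edge, so the in-flow counts the vertices with an
    -- incoming edge of colour l; those without an outgoing one are the sinks.
    in+source≈out+sink : ∀ k → inflow k + ι F (∑ℕ (sources k)) ≈ outflow k + ι F (∑ℕ (sinks k))
    in+source≈out+sink k = begin
      inflow k + ι F (∑ℕ (sources k))
        ≈⟨ +-cong (∑-cong (λ e → reflexive (cong (λ b → if b then y (csuc e) k else 0#)
                                                 (⌊⌋-⇔ (col e ≟ l) (hasIn? col l (csuc e)) (hasIn⇔ e)))))
                  (ι-∑ (sources k)) ⟩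
      ∑ F (entering ∘ csuc) + ∑ F (ι F ∘ sources k)   ≈⟨ +-congʳ (∑-rotate entering) ⟩
      ∑ F entering + ∑ F (ι F ∘ sources k)            ≈⟨ ∑-distrib-+ entering (ι F ∘ sources k) ⟨
      ∑ F (λ v → entering v + ι F (sources k v))
        ≈⟨ ∑-cong (λ v → pointwise (hasIn? col l v) (hasOut? col l v) (Y v k)) ⟩
      ∑ F (λ v → leaving v + ι F (sinks k v))          ≈⟨ ∑-distrib-+ leaving (ι F ∘ sinks k) ⟩
      ∑ F leaving + ∑ F (ι F ∘ sinks k)
        ≈⟨ +-cong (∑-cong (λ e → reflexive (cong (λ b → if b then y e k else 0#)
                                                 (⌊⌋-⇔ (col e ≟ l) (hasOut? col l e) (hasOut⇔ e)))))
                  (ι-∑ (sinks k)) ⟨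
      outflow k + ι F (∑ℕ (sinks k))                   ∎
      where
      entering leaving : Fin m → Carrier
      entering v = if ⌊ hasIn? col l v ⌋ then y v k else 0#
      leaving  v = if ⌊ hasOut? col l v ⌋ then y v k else 0#

      pointwise : ∀ {a b} {A : Set a} {B : Set b} (in? : Dec A) (out? : Dec B) n →
        (if ⌊ in? ⌋ then ι F n else 0#) + ι F (if ⌊ out? ×-dec ¬? in? ⌋ then n else 0) ≈
        (if ⌊ out? ⌋ then ι F n else 0#) + ι F (if ⌊ in? ×-dec ¬? out? ⌋ then n else 0)
      pointwise (yes _) (yes _) n = refl
      pointwise (yes _) (no  _) n = +-comm _ _
      pointwise (no  _) (yes _) n = +-comm _ _
      pointwise (no  _) (no  _) n = refl

    kernel-row⇔balanced : ∀ k → (∑ F (λ e → Σmat F Y κ k e * restrict col l κ⁻¹ e) ≈ 0#) ⇔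
                                (∑ℕ (sources k) ≡ ∑ℕ (sinks k))
    kernel-row⇔balanced k =
      mk⇔ ι-injective (reflexive ∘ cong (ι F)) ⇔-∘
      (+-exchange (in+source≈out+sink k) ⇔-∘
      (x-y≈0⇔x≈y ⇔-∘
      mk⇔ (trans (sym (restricted-κ⁻¹-action k))) (trans (restricted-κ⁻¹-action k))))

    restricted-κ⁻¹-inKer⇔balanced : InKer F (Σmat F Y κ) (restrict col l κ⁻¹) ⇔ BalancedColour Y col l
    restricted-κ⁻¹-inKer⇔balanced =
      mk⇔ (λ ∈ker k → Equivalence.to (kernel-row⇔balanced k) (∈ker k))
          (λ balanced k → Equivalence.from (kernel-row⇔balanced k) (balanced k))

theorem4p1 : ∀ {c ℓ} (F : OrderedField c ℓ) (m s : ℕ) → 2 ≤ m →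
    (Y : Fin m → Fin s → ℕ) →
    (∀ i j → (∀ k → Y i k ≡ Y j k) → i ≡ j) →
    (κ : Fin m → OrderedField.Carrier F) →
    (∀ i → OrderedField._<_ F (OrderedField.0# F) (κ i)) →
    (d : ℕ) → DimKer F (Σmat F Y κ) d →
    PDSC F Y κ d ⇔ GoodColoring Y d
theorem4p1 F m s _ Y _ κ κ>0 d (_ , _ , _ , b₀-spans) = mk⇔ pdsc⇒good good⇒pdsc
  where
  open OrderedField F using (Carrier)
  open LinearAlgebra F
  open CycleNetwork F Y κ κ>0

  pdsc⇒good : PDSC F Y κ d → GoodColoring Y d
  pdsc⇒good (p , p-surj , b , b-basis , b-supp) = p , p-surj , λ l →
    Equivalence.to (restricted-κ⁻¹-inKer⇔balanced p l) (restrict-inKer b-basis b-supp κ⁻¹-inKer l)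

  good⇒pdsc : GoodColoring Y d → PDSC F Y κ d
  good⇒pdsc (col , col-surj , balanced) =
    col , col-surj , v ,
    (v∈ker , v-independent , independent⇒spansKer b₀-spans v∈ker v-independent) , v-supp
    where
    v : Fin d → Fin m → Carrier
    v l = restrict col l κ⁻¹

    v∈ker : ∀ l → InKer F (Σmat F Y κ) (v l)
    v∈ker l = Equivalence.from (restricted-κ⁻¹-inKer⇔balanced col l) (balanced l)

    v-supp : BlockSupported col v
    v-supp = restrict-blockSupported κ⁻¹≉0

    v-independent : Independent v
    v-independent = blockSupported⇒independent col-surj v-supp
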